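{- Let $s,t$ be indeterminates, and in $\mathbf{Sym}$ over $\mathbb{Q}(s,t)$ let $Y=\sum_{n\ge1}Y_n:=\sum_{k\ge1}E_k(s,t)\frac{\varphi^k}{k!}$, with $Y_n$ homogeneous of degree $n$. Then for every $n\ge1$, $$Y_n=\sum_{r=1}^n\frac1{r!}\Bigl(\sum_{k=1}^r s(r,k)E_k(s,t)\Bigr)S_n^{[r]},$$ where $s(r,k)$ are the signed Stirling numbers of the first kind and $S_n^{[r]}=\sum_{I\vDash n,\ \ell(I)=r}S^I$.
   Context: $\mathbf{Sym}$ is the free associative algebra on noncommuting $S_1,S_2,\dots$ ($S_0=1$, $\deg S_n=n$); for a composition $I=(i_1,\dots,i_r)$ of $n$, $S^I=S_{i_1}\cdots S_{i_r}$, $\ell(I)=r$. $\varphi=\log\sigma_1$ with $\sigma_1=\sum_{n\ge0}S_n$. $E_n(s,t)=\sum_{\sigma\in\mathfrak S_n}s^{r(\sigma)}t^{d(\sigma)}$ is the homogeneous Eulerian polynomial, where $r(\sigma)$ (resp. $d(\sigma)$) is the number of $i\in\{1,\dots,n-1\}$ with $\sigma(i)<\sigma(i+1)$ (resp. $\sigma(i)>\sigma(i+1)$). Signed Stirling numbers of the first kind are defined by $x(x-1)\cdots(x-r+1)=\sum_k s(r,k)x^k$. -}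

module Defs where

open import Data.Nat as ℕ using (ℕ; zero; suc; _!; _<ᵇ_; _≡ᵇ_)
open import Data.Nat.Properties using (_!≢0)
open import Data.Integer as ℤ using (ℤ; +_; -[1+_])
open import Data.Rational as ℚ using (ℚ; 0ℚ; 1ℚ; _/_)
open import Data.List using (List; []; _∷_; length; map; concatMap)
open import Data.Nat.ListAction using (sum)
open import Data.Product using (_×_; _,_)
open import Data.Bool using (Bool; true; false; if_then_else_; _∧_)

Σ₁ : ℕ → (ℕ → ℚ) → ℚ
Σ₁ zero    f = 0ℚ
Σ₁ (suc n) f = Σ₁ n f ℚ.+ f (suc n)

Σ₁ℤ : ℕ → (ℕ → ℤ) → ℤ
Σ₁ℤ zero    f = + 0
Σ₁ℤ (suc n) f = Σ₁ℤ n f ℤ.+ f (suc n)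

ℕ→ℚ : ℕ → ℚ
ℕ→ℚ n = (+ n) / 1

ℤ→ℚ : ℤ → ℚ
ℤ→ℚ z = z / 1

inv! : ℕ → ℚ
inv! k = (+ 1) / (k !)
  where instance _ = k !≢0

-- Coefficients: polynomials in the indeterminates s, t over ℚ, given by
-- their coefficient functions  (a , b) ↦ [s^a t^b] p.
-- (All coefficients occurring are polynomials, Q[s,t] ⊂ Q(s,t).)
-- Two polynomials are equal iff all coefficients agree.

Poly : Set
Poly = ℕ → ℕ → ℚ

-- Homogeneous Eulerian polynomial  E_n(s,t) = Σ_σ s^{r(σ)} t^{d(σ)}.

insertAll : ℕ → List ℕ → List (List ℕ)
insertAll x []       = (x ∷ []) ∷ []
insertAll x (y ∷ ys) = (x ∷ y ∷ ys) ∷ map (y ∷_) (insertAll x ys)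

perms : ℕ → List (List ℕ)
perms zero    = [] ∷ []
perms (suc n) = concatMap (insertAll n) (perms n)

b2n : Bool → ℕ
b2n true  = 1
b2n false = 0

rises : List ℕ → ℕ
rises (x ∷ y ∷ zs) = b2n (x <ᵇ y) ℕ.+ rises (y ∷ zs)
rises _            = 0

descents : List ℕ → ℕ
descents (x ∷ y ∷ zs) = b2n (y <ᵇ x) ℕ.+ descents (y ∷ zs)
descents _            = 0

E : ℕ → Poly
E n a b = ℕ→ℚ (sum (map (λ σ → b2n ((rises σ ≡ᵇ a) ∧ (descents σ ≡ᵇ b))) (perms n)))

-- Signed Stirling numbers of the first kind:
-- coefficient list of the falling factorial x(x-1)…(x-r+1), computed
-- by multiplying by (x - r) at each step.

fallingCoeff : ℕ → ℕ → ℤ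
fallingCoeff zero    zero    = + 1
fallingCoeff zero    (suc k) = + 0
fallingCoeff (suc r) zero    = ℤ.- ((+ r) ℤ.* fallingCoeff r zero)
fallingCoeff (suc r) (suc k) = fallingCoeff r k ℤ.- ((+ r) ℤ.* fallingCoeff r (suc k))

stirling1 : ℕ → ℕ → ℤ
stirling1 = fallingCoeff

-- A word  j₁ ∷ … ∷ jᵣ  stands for the monomial S^I = S_{j₁+1} ⋯ S_{jᵣ+1},
-- i.e. I = (j₁+1, …, jᵣ+1); these monomials form a basis of Sym.
-- An element of the completion is its coefficient function on words.

Word : Set
Word = List ℕ

deg : Word → ℕ
deg w = sum (map suc w)

Ser : Set
Ser = Word → ℚ

splits : Word → List (Word × Word)
splits []       = ([] , []) ∷ []
splits (x ∷ xs) = ([] , x ∷ xs) ∷ map (λ { (u , v) → (x ∷ u , v) }) (splits xs)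

_⋆_ : Ser → Ser → Ser
(f ⋆ g) w = sum' (splits w)
  where
  sum' : List (Word × Word) → ℚ
  sum' []             = 0ℚ
  sum' ((u , v) ∷ ps) = f u ℚ.* g v ℚ.+ sum' ps

unit : Ser
unit []      = 1ℚ
unit (_ ∷ _) = 0ℚ

_^⋆_ : Ser → ℕ → Ser
f ^⋆ zero  = unit
f ^⋆ suc k = f ⋆ (f ^⋆ k)

-- σ₁ - 1 = Σ_{n≥1} S_n : coefficient 1 on words of length 1
σ₁-1 : Ser
σ₁-1 (_ ∷ []) = 1ℚ
σ₁-1 _        = 0ℚ

logCoeff : ℕ → ℚ
logCoeff zero    = 0ℚ
logCoeff (suc m) = sgn m / suc m
  where
  sgn : ℕ → ℤ
  sgn zero          = + 1
  sgn (suc zero)    = -[1+ 0 ]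
  sgn (suc (suc i)) = sgn i

-- φ = log σ₁ = Σ_{m≥1} (-1)^{m-1}/m (σ₁-1)^m.  At a word w only the
-- terms m ≤ length w can be nonzero ((σ₁-1)^m is supported on words of
-- length exactly m), so the series is evaluated by the finite sum.
φ : Ser
φ w = Σ₁ (length w) (λ m → logCoeff m ℚ.* (σ₁-1 ^⋆ m) w)

SerP : Set
SerP = Word → Poly

-- Y_n : degree-n component of Y = Σ_{k≥1} E_k(s,t) φ^k / k!.
-- Since φ^k has no component of degree < k, only k ≤ n contributes.
Ycomp : ℕ → SerP
Ycomp n w a b =
  if deg w ≡ᵇ n
  then Σ₁ n (λ k → (inv! k ℚ.* (φ ^⋆ k) w) ℚ.* E k a b)
  else 0ℚ

S[_,_] : ℕ → ℕ → Ser
S[ n , r ] w = if (deg w ≡ᵇ n) ∧ (length w ≡ᵇ r) then 1ℚ else 0ℚ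

RHS : ℕ → SerP
RHS n w a b =
  Σ₁ n (λ r → (inv! r ℚ.* Σ₁ r (λ k → ℤ→ℚ (stirling1 r k) ℚ.* E k a b))
              ℚ.* S[ n , r ] w)

{-# OPTIONS --safe #-}
module Submission where

-- Every coefficient of φ^k in the basis S^I depends only on ℓ(I): it is
-- [x^ℓ(I)] L(x)^k with L(x) = log(1 + x), because σ₁ - 1 contributes x per
-- letter.  The operator θ = (1 + x) d/dx is a derivation with θ L = 1, so
-- θ (L^(k+1)) = (k+1) L^k; on coefficients this is exactly the recurrence of
-- the Stirling numbers, whence L^k / k! = Σ_m s(m,k) x^m / m!.  Collecting
-- the words of degree n by length gives the theorem.

open import Defs
open import Data.Bool using (T; if_then_else_; true; false)
open import Data.Integer as ℤ using (ℤ; -[1+_]; +0; +[1+_])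
import Data.Integer.Properties as ℤP
open import Data.List using (List; []; _∷_; length; foldr)
open import Data.List.Properties using (foldr-map; foldr-cong)
open import Data.Nat as ℕ using (ℕ; zero; suc; _!; _≤_; _<_; _≡ᵇ_; z≤n; s≤s)
import Data.Nat.Properties as ℕP
import Data.Nat.Coprimality as Coprime
open import Data.Product using (_,_; uncurry)
open import Data.Rational as ℚ using (ℚ; 0ℚ; 1ℚ; _/_; mkℚ; _+_; _*_; -_)
import Data.Rational.Properties as ℚP
import Data.Rational.Unnormalised as ℚᵘ
import Data.Rational.Unnormalised.Properties as ℚᵘP
open import Data.Rational.Solver using (module +-*-Solver)
open +-*-Solver using (solve; _:+_; _:*_; :-_; _:=_; con)
open import Data.Sum using (inj₁; inj₂)
open import Relation.Binary.PropositionalEquality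
open import Data.Empty using (⊥-elim)
open import Function using (_∘_)
open import Algebra.Bundles using (CommutativeMonoid)
open import Algebra.Properties.CommutativeSemigroup
  (CommutativeMonoid.commutativeSemigroup ℚP.+-0-commutativeMonoid)
  using () renaming (interchange to +-interchange)
open import Algebra.Properties.CommutativeSemigroup
  (CommutativeMonoid.commutativeSemigroup ℚP.*-1-commutativeMonoid)
  using () renaming (x∙yz≈y∙xz to *-exchange)

ℤ→ℚ≡mkℚ : ∀ z → ℤ→ℚ z ≡ mkℚ z 0 (Coprime.sym (Coprime.1-coprimeTo _))
ℤ→ℚ≡mkℚ z = ℚP.↥p/↧p≡p (mkℚ z 0 (Coprime.sym (Coprime.1-coprimeTo _)))

ℤ→ℚ-homo-+ : ∀ x y → ℤ→ℚ (x ℤ.+ y) ≡ ℤ→ℚ x + ℤ→ℚ y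
ℤ→ℚ-homo-+ x y rewrite ℤ→ℚ≡mkℚ x | ℤ→ℚ≡mkℚ y =
  cong (_/ 1) (cong₂ ℤ._+_ (sym (ℤP.*-identityʳ x)) (sym (ℤP.*-identityʳ y)))

ℤ→ℚ-homo-* : ∀ x y → ℤ→ℚ (x ℤ.* y) ≡ ℤ→ℚ x * ℤ→ℚ y
ℤ→ℚ-homo-* x y rewrite ℤ→ℚ≡mkℚ x | ℤ→ℚ≡mkℚ y = refl

ℤ→ℚ-homo‿- : ∀ x → ℤ→ℚ (ℤ.- x) ≡ - ℤ→ℚ x
ℤ→ℚ-homo‿- x rewrite ℤ→ℚ≡mkℚ x | ℤ→ℚ≡mkℚ (ℤ.- x) with x
... | +0       = refl
... | +[1+ _ ] = refl
... | -[1+ _ ] = refl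

ℕ→ℚ-homo-* : ∀ x y → ℕ→ℚ (x ℕ.* y) ≡ ℕ→ℚ x * ℕ→ℚ y
ℕ→ℚ-homo-* x y = trans (cong ℤ→ℚ (ℤP.pos-* x y)) (ℤ→ℚ-homo-* (ℤ.+ x) (ℤ.+ y))

ℕ→ℚ-suc : ∀ i → ℕ→ℚ (suc i) ≡ 1ℚ + ℕ→ℚ i
ℕ→ℚ-suc i = trans (cong ℤ→ℚ (ℤP.pos-+ 1 i)) (ℤ→ℚ-homo-+ (ℤ.+ 1) (ℤ.+ i))

inv!-inverseˡ : ∀ k → inv! k * ℕ→ℚ (k !) ≡ 1ℚ
inv!-inverseˡ k = lemma (k !) {{k ℕP.!≢0}}
  where
  lemma : ∀ n .{{_ : ℕ.NonZero n}} → (ℤ.+ 1 / n) * ℕ→ℚ n ≡ 1ℚ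
  lemma (suc n) rewrite ℚP.normalize-coprime {1} {n} (Coprime.1-coprimeTo _)
                      | ℤ→ℚ≡mkℚ (ℤ.+ suc n) =
    ℚP.*-inverseˡ (mkℚ (ℤ.+ suc n) 0 (Coprime.sym (Coprime.1-coprimeTo _)))

ℕ→ℚ-*-/-cancel : ∀ m z → ℕ→ℚ (suc m) * (z / suc m) ≡ ℤ→ℚ z
ℕ→ℚ-*-/-cancel m z = ℚP.toℚᵘ-injective (begin
  ℚ.toℚᵘ (ℕ→ℚ (suc m) * (z / suc m))
    ≈⟨ ℚP.toℚᵘ-homo-* (ℕ→ℚ (suc m)) (z / suc m) ⟩
  ℚ.toℚᵘ (ℕ→ℚ (suc m)) ℚᵘ.* ℚ.toℚᵘ (z / suc m)
    ≈⟨ ℚᵘP.*-cong (ℚP.toℚᵘ-fromℚᵘ (ℚᵘ.mkℚᵘ (ℤ.+ suc m) 0))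
                  (ℚP.toℚᵘ-fromℚᵘ (ℚᵘ.mkℚᵘ z m)) ⟩
  ℚᵘ.mkℚᵘ (ℤ.+ suc m) 0 ℚᵘ.* ℚᵘ.mkℚᵘ z m
    ≈⟨ ℚᵘ.*≡* (trans (ℤP.*-identityʳ _)
                (trans (ℤP.*-comm (ℤ.+ suc m) z)
                       (cong (λ q → z ℤ.* ℤ.+ suc q) (sym (ℕP.+-identityʳ m))))) ⟩
  ℚᵘ.mkℚᵘ z 0
    ≈⟨ ℚᵘP.≃-sym (ℚP.toℚᵘ-fromℚᵘ (ℚᵘ.mkℚᵘ z 0)) ⟩
  ℚ.toℚᵘ (ℤ→ℚ z) ∎)
  where open ℚᵘP.≃-Reasoning

open ≡-Reasoning

Σ₁-cong : ∀ n {f g : ℕ → ℚ} → (∀ k → f k ≡ g k) → Σ₁ n f ≡ Σ₁ n g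
Σ₁-cong zero    f≗g = refl
Σ₁-cong (suc n) f≗g = cong₂ _+_ (Σ₁-cong n f≗g) (f≗g (suc n))

*-distribˡ-Σ₁ : ∀ n c (f : ℕ → ℚ) → c * Σ₁ n f ≡ Σ₁ n (λ k → c * f k)
*-distribˡ-Σ₁ zero    c f = ℚP.*-zeroʳ c
*-distribˡ-Σ₁ (suc n) c f =
  trans (ℚP.*-distribˡ-+ c (Σ₁ n f) (f (suc n))) (cong (_+ c * f (suc n)) (*-distribˡ-Σ₁ n c f))

Σ₁-zero : ∀ n (f : ℕ → ℚ) → (∀ k → k ≤ n → f k ≡ 0ℚ) → Σ₁ n f ≡ 0ℚ
Σ₁-zero zero    f f≡0 = refl
Σ₁-zero (suc n) f f≡0 = begin
  Σ₁ n f + f (suc n) ≡⟨ cong₂ _+_ (Σ₁-zero n f (λ k k≤n → f≡0 k (ℕP.m≤n⇒m≤1+n k≤n)))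
                                  (f≡0 (suc n) ℕP.≤-refl) ⟩
  0ℚ + 0ℚ            ≡⟨ ℚP.+-identityʳ 0ℚ ⟩
  0ℚ                 ∎

Σ₁-truncate : ∀ n m (f : ℕ → ℚ) → m ≤ n → (∀ k → m < k → f k ≡ 0ℚ) →
  Σ₁ n f ≡ Σ₁ m f
Σ₁-truncate n m f m≤n f≡0 with ℕP.m≤n⇒m<n∨m≡n m≤n
Σ₁-truncate (suc n) m f _ f≡0 | inj₁ m<1+n = begin
  Σ₁ n f + f (suc n) ≡⟨ cong₂ _+_ (Σ₁-truncate n m f (ℕP.≤-pred m<1+n) f≡0)
                                  (f≡0 (suc n) m<1+n) ⟩
  Σ₁ m f + 0ℚ        ≡⟨ ℚP.+-identityʳ (Σ₁ m f) ⟩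
  Σ₁ m f             ∎
Σ₁-truncate n .n f _ f≡0 | inj₂ refl = refl

δ : ℕ → ℕ → ℚ
δ m r = if m ≡ᵇ r then 1ℚ else 0ℚ

δ-refl : ∀ m → δ m m ≡ 1ℚ
δ-refl zero    = refl
δ-refl (suc m) = δ-refl m

δ-≢ : ∀ m r → m ≢ r → δ m r ≡ 0ℚ
δ-≢ zero    zero    m≢r = ⊥-elim (m≢r refl)
δ-≢ zero    (suc r) m≢r = refl
δ-≢ (suc m) zero    m≢r = refl
δ-≢ (suc m) (suc r) m≢r = δ-≢ m r (m≢r ∘ cong suc)

Σ₁-δ : ∀ n m (f : ℕ → ℚ) → 1 ≤ m → m ≤ n → Σ₁ n (λ r → f r * δ m r) ≡ f m
Σ₁-δ n (suc m) f _ 1+m≤n = begin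
  Σ₁ n g
    ≡⟨ Σ₁-truncate n (suc m) g 1+m≤n (λ r m<r → f[r]*δ≡0 r (ℕP.<⇒≢ m<r)) ⟩
  Σ₁ m g + f (suc m) * δ m m
    ≡⟨ cong₂ _+_ (Σ₁-zero m g (λ r r≤m → f[r]*δ≡0 r (ℕP.<⇒≢ (s≤s r≤m) ∘ sym)))
                 (cong (f (suc m) *_) (δ-refl m)) ⟩
  0ℚ + f (suc m) * 1ℚ
    ≡⟨ trans (ℚP.+-identityˡ _) (ℚP.*-identityʳ (f (suc m))) ⟩
  f (suc m) ∎
  where
  g : ℕ → ℚ
  g r = f r * δ (suc m) r
  f[r]*δ≡0 : ∀ r → suc m ≢ r → g r ≡ 0ℚ
  f[r]*δ≡0 r m≢r = trans (cong (f r *_) (δ-≢ (suc m) r m≢r)) (ℚP.*-zeroʳ (f r))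

Series : Set
Series = ℕ → ℚ

0ₛ : Series
0ₛ _ = 0ℚ

infixl 6 _+ₛ_
_+ₛ_ : Series → Series → Series
(F +ₛ G) i = F i + G i

infixr 7 _·ₛ_
_·ₛ_ : ℚ → Series → Series
(c ·ₛ F) i = c * F i

tail : Series → Series
tail F i = F (suc i)

infixl 7 _⊛_
_⊛_ : Series → Series → Series
(F ⊛ G) zero    = F 0 * G 0
(F ⊛ G) (suc m) = F 0 * G (suc m) + (tail F ⊛ G) m

infixr 8 _^⊛_
_^⊛_ : Series → ℕ → Series
F ^⊛ zero  = δ 0
F ^⊛ suc k = F ⊛ F ^⊛ k

⊛-cong : ∀ {F F′ G G′} → F ≗ F′ → G ≗ G′ → F ⊛ G ≗ F′ ⊛ G′
⊛-cong F≗F′ G≗G′ zero    = cong₂ _*_ (F≗F′ 0) (G≗G′ 0)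
⊛-cong F≗F′ G≗G′ (suc m) =
  cong₂ _+_ (cong₂ _*_ (F≗F′ 0) (G≗G′ (suc m))) (⊛-cong (F≗F′ ∘ suc) G≗G′ m)

⊛-zeroˡ : ∀ G → 0ₛ ⊛ G ≗ 0ₛ
⊛-zeroˡ G zero    = ℚP.*-zeroˡ (G 0)
⊛-zeroˡ G (suc m) = trans (cong₂ _+_ (ℚP.*-zeroˡ (G (suc m))) (⊛-zeroˡ G m)) (ℚP.+-identityʳ 0ℚ)

⊛-zeroʳ : ∀ F → F ⊛ 0ₛ ≗ 0ₛ
⊛-zeroʳ F zero    = ℚP.*-zeroʳ (F 0)
⊛-zeroʳ F (suc m) = trans (cong₂ _+_ (ℚP.*-zeroʳ (F 0)) (⊛-zeroʳ (tail F) m)) (ℚP.+-identityʳ 0ℚ)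

⊛-identityˡ : ∀ G → δ 0 ⊛ G ≗ G
⊛-identityˡ G zero    = ℚP.*-identityˡ (G 0)
⊛-identityˡ G (suc m) = trans (cong₂ _+_ (ℚP.*-identityˡ (G (suc m))) (⊛-zeroˡ G m)) (ℚP.+-identityʳ _)

δ₁-⊛-suc : ∀ G m → (δ 1 ⊛ G) (suc m) ≡ G m
δ₁-⊛-suc G m = trans (cong₂ _+_ (ℚP.*-zeroˡ (G (suc m))) (⊛-identityˡ G m)) (ℚP.+-identityˡ (G m))

δ₁-^⊛ : ∀ j m → (δ 1 ^⊛ j) m ≡ δ m j
δ₁-^⊛ zero    zero    = refl
δ₁-^⊛ zero    (suc m) = refl
δ₁-^⊛ (suc j) zero    = ℚP.*-zeroˡ ((δ 1 ^⊛ j) 0)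
δ₁-^⊛ (suc j) (suc m) = trans (δ₁-⊛-suc (δ 1 ^⊛ j) m) (δ₁-^⊛ j m)

⊛-distribʳ-+ₛ : ∀ A B G → (A +ₛ B) ⊛ G ≗ A ⊛ G +ₛ B ⊛ G
⊛-distribʳ-+ₛ A B G zero    = ℚP.*-distribʳ-+ (G 0) (A 0) (B 0)
⊛-distribʳ-+ₛ A B G (suc m) = begin
  (A 0 + B 0) * G (suc m) + ((tail A +ₛ tail B) ⊛ G) m
    ≡⟨ cong₂ _+_ (ℚP.*-distribʳ-+ (G (suc m)) (A 0) (B 0)) (⊛-distribʳ-+ₛ (tail A) (tail B) G m) ⟩
  (A 0 * G (suc m) + B 0 * G (suc m)) + ((tail A ⊛ G) m + (tail B ⊛ G) m)
    ≡⟨ +-interchange (A 0 * G (suc m)) (B 0 * G (suc m)) ((tail A ⊛ G) m) ((tail B ⊛ G) m) ⟩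
  (A 0 * G (suc m) + (tail A ⊛ G) m) + (B 0 * G (suc m) + (tail B ⊛ G) m) ∎

⊛-distribˡ-+ₛ : ∀ F A B → F ⊛ (A +ₛ B) ≗ F ⊛ A +ₛ F ⊛ B
⊛-distribˡ-+ₛ F A B zero    = ℚP.*-distribˡ-+ (F 0) (A 0) (B 0)
⊛-distribˡ-+ₛ F A B (suc m) = begin
  F 0 * (A (suc m) + B (suc m)) + (tail F ⊛ (A +ₛ B)) m
    ≡⟨ cong₂ _+_ (ℚP.*-distribˡ-+ (F 0) (A (suc m)) (B (suc m))) (⊛-distribˡ-+ₛ (tail F) A B m) ⟩
  (F 0 * A (suc m) + F 0 * B (suc m)) + ((tail F ⊛ A) m + (tail F ⊛ B) m)
    ≡⟨ +-interchange (F 0 * A (suc m)) (F 0 * B (suc m)) ((tail F ⊛ A) m) ((tail F ⊛ B) m) ⟩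
  (F 0 * A (suc m) + (tail F ⊛ A) m) + (F 0 * B (suc m) + (tail F ⊛ B) m) ∎

⊛-scaleʳ : ∀ F c A → F ⊛ (c ·ₛ A) ≗ c ·ₛ (F ⊛ A)
⊛-scaleʳ F c A zero    = solve 3 (λ f c a → f :* (c :* a) := c :* (f :* a)) refl (F 0) c (A 0)
⊛-scaleʳ F c A (suc m) = begin
  F 0 * (c * A (suc m)) + (tail F ⊛ (c ·ₛ A)) m
    ≡⟨ cong (F 0 * (c * A (suc m)) +_) (⊛-scaleʳ (tail F) c A m) ⟩
  F 0 * (c * A (suc m)) + c * (tail F ⊛ A) m
    ≡⟨ solve 4 (λ f c a x → f :* (c :* a) :+ c :* x := c :* (f :* a :+ x))
         refl (F 0) c (A (suc m)) ((tail F ⊛ A) m) ⟩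
  c * (F 0 * A (suc m) + (tail F ⊛ A) m) ∎

⊛-sucʳ : ∀ F G m → (F ⊛ G) (suc m) ≡ (F ⊛ tail G) m + F (suc m) * G 0
⊛-sucʳ F G zero    = refl
⊛-sucʳ F G (suc m) = begin
  F 0 * G (suc (suc m)) + (tail F ⊛ G) (suc m)
    ≡⟨ cong (F 0 * G (suc (suc m)) +_) (⊛-sucʳ (tail F) G m) ⟩
  F 0 * G (suc (suc m)) + ((tail F ⊛ tail G) m + F (suc (suc m)) * G 0)
    ≡⟨ ℚP.+-assoc (F 0 * G (suc (suc m))) ((tail F ⊛ tail G) m) (F (suc (suc m)) * G 0) ⟨
  F 0 * G (suc (suc m)) + (tail F ⊛ tail G) m + F (suc (suc m)) * G 0 ∎

∂ : Series → Series
∂ A i = ℕ→ℚ (suc i) * A (suc i)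

x∂ : Series → Series
x∂ A i = ℕ→ℚ i * A i

θ : Series → Series
θ A = ∂ A +ₛ x∂ A

x∂-leibniz : ∀ A B → x∂ (A ⊛ B) ≗ x∂ A ⊛ B +ₛ A ⊛ x∂ B
x∂-leibniz A B zero =
  solve 2 (λ a b → con 0ℚ :* (a :* b) := con 0ℚ :* a :* b :+ a :* (con 0ℚ :* b)) refl (A 0) (B 0)
x∂-leibniz A B (suc n) = begin
  ℕ→ℚ (suc n) * (a * b + Z)
    ≡⟨ cong (_* (a * b + Z)) (ℕ→ℚ-suc n) ⟩
  (1ℚ + k) * (a * b + Z)
    ≡⟨ solve 4 (λ k a b z → (con 1ℚ :+ k) :* (a :* b :+ z) := a :* ((con 1ℚ :+ k) :* b) :+ z :+ k :* z)
         refl k a b Z ⟩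
  a * ((1ℚ + k) * b) + Z + k * Z
    ≡⟨ cong (a * ((1ℚ + k) * b) + Z +_) (x∂-leibniz (tail A) B n) ⟩
  a * ((1ℚ + k) * b) + Z + (X + Y)
    ≡⟨ solve 6 (λ a b c z x y → a :* c :+ z :+ (x :+ y) := con 0ℚ :* a :* b :+ (x :+ z) :+ (a :* c :+ y))
         refl a b ((1ℚ + k) * b) Z X Y ⟩
  0ℚ * a * b + (X + Z) + (a * ((1ℚ + k) * b) + Y)
    ≡⟨ cong₂ _+_ (cong (0ℚ * a * b +_) tail-x∂) (cong (λ c → a * (c * b) + Y) (ℕ→ℚ-suc n)) ⟨
  (x∂ A ⊛ B) (suc n) + (A ⊛ x∂ B) (suc n) ∎
  where
  k a b Z X Y : ℚ
  k = ℕ→ℚ n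
  a = A 0
  b = B (suc n)
  Z = (tail A ⊛ B) n
  X = (x∂ (tail A) ⊛ B) n
  Y = (tail A ⊛ x∂ B) n
  tail-x∂ : (tail (x∂ A) ⊛ B) n ≡ X + Z
  tail-x∂ = trans (⊛-cong tail-x∂≗x∂-tail+tail (λ _ → refl) n)
                  (⊛-distribʳ-+ₛ (x∂ (tail A)) (tail A) B n)
    where
    tail-x∂≗x∂-tail+tail : tail (x∂ A) ≗ x∂ (tail A) +ₛ tail A
    tail-x∂≗x∂-tail+tail i = trans (cong (_* A (suc i)) (ℕ→ℚ-suc i))
      (solve 2 (λ k x → (con 1ℚ :+ k) :* x := k :* x :+ x) refl (ℕ→ℚ i) (A (suc i)))

-- ∂ F m is x∂ F (suc m), so this is x∂-leibniz one degree up.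
∂-leibniz : ∀ A B → ∂ (A ⊛ B) ≗ ∂ A ⊛ B +ₛ A ⊛ ∂ B
∂-leibniz A B m = begin
  x∂ (A ⊛ B) (suc m)
    ≡⟨ x∂-leibniz A B (suc m) ⟩
  0ℚ * A 0 * B (suc m) + (∂ A ⊛ B) m + (A ⊛ x∂ B) (suc m)
    ≡⟨ cong (0ℚ * A 0 * B (suc m) + (∂ A ⊛ B) m +_) (⊛-sucʳ A (x∂ B) m) ⟩
  0ℚ * A 0 * B (suc m) + (∂ A ⊛ B) m + ((A ⊛ ∂ B) m + A (suc m) * (0ℚ * B 0))
    ≡⟨ solve 6 (λ a b x y a′ b′ → con 0ℚ :* a :* b :+ x :+ (y :+ a′ :* (con 0ℚ :* b′)) := x :+ y)
         refl (A 0) (B (suc m)) ((∂ A ⊛ B) m) ((A ⊛ ∂ B) m) (A (suc m)) (B 0) ⟩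
  (∂ A ⊛ B) m + (A ⊛ ∂ B) m ∎

θ-leibniz : ∀ A B → θ (A ⊛ B) ≗ θ A ⊛ B +ₛ A ⊛ θ B
θ-leibniz A B m = begin
  ∂ (A ⊛ B) m + x∂ (A ⊛ B) m
    ≡⟨ cong₂ _+_ (∂-leibniz A B m) (x∂-leibniz A B m) ⟩
  ((∂ A ⊛ B) m + (A ⊛ ∂ B) m) + ((x∂ A ⊛ B) m + (A ⊛ x∂ B) m)
    ≡⟨ +-interchange ((∂ A ⊛ B) m) ((A ⊛ ∂ B) m) ((x∂ A ⊛ B) m) ((A ⊛ x∂ B) m) ⟩
  ((∂ A ⊛ B) m + (x∂ A ⊛ B) m) + ((A ⊛ ∂ B) m + (A ⊛ x∂ B) m)
    ≡⟨ cong₂ _+_ (⊛-distribʳ-+ₛ (∂ A) (x∂ A) B m) (⊛-distribˡ-+ₛ A (∂ B) (x∂ B) m) ⟨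
  (θ A ⊛ B +ₛ A ⊛ θ B) m ∎

altSign : ℕ → ℤ
altSign zero    = ℤ.+ 1
altSign (suc m) = ℤ.- altSign m

alternating-numerator : ∀ d {T : ℕ → ℚ} → T 0 ≡ ℤ.+ 1 / suc d → T 1 ≡ -[1+ 0 ] / suc d →
  (∀ i → T (suc (suc i)) ≡ T i) → ∀ i → T i ≡ altSign i / suc d
alternating-numerator d T0 T1 T-period zero          = T0
alternating-numerator d T0 T1 T-period (suc zero)    = T1
alternating-numerator d T0 T1 T-period (suc (suc i)) =
  trans (T-period i) (trans (alternating-numerator d T0 T1 T-period i)
                            (cong (_/ suc d) (sym (ℤP.neg-involutive (altSign i)))))

-- The sign sequence inside logCoeff is local to Defs and cannot be named;
-- once the denominator is abstracted, alternating-numerator identifies it.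
logCoeff-suc : ∀ m → logCoeff (suc m) ≡ altSign m / suc m
logCoeff-suc zero          = refl
logCoeff-suc (suc zero)    = refl
logCoeff-suc (suc (suc i)) with suc (suc i)
... | d with alternating-numerator d refl refl (λ _ → refl) | i
...   | numerator | j =
  trans (numerator j) (cong (_/ suc d) (sym (ℤP.neg-involutive (altSign j))))

θ-logCoeff : θ logCoeff ≗ δ 0
θ-logCoeff zero    = refl
θ-logCoeff (suc m) = begin
  ℕ→ℚ (suc (suc m)) * logCoeff (suc (suc m)) + ℕ→ℚ (suc m) * logCoeff (suc m)
    ≡⟨ cong₂ _+_ (scaled (suc m)) (scaled m) ⟩
  ℤ→ℚ (ℤ.- altSign m) + ℤ→ℚ (altSign m)
    ≡⟨ ℤ→ℚ-homo-+ (ℤ.- altSign m) (altSign m) ⟨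
  ℤ→ℚ (ℤ.- altSign m ℤ.+ altSign m)
    ≡⟨ cong ℤ→ℚ (ℤP.+-inverseˡ (altSign m)) ⟩
  0ℚ ∎
  where
  scaled : ∀ i → ℕ→ℚ (suc i) * logCoeff (suc i) ≡ ℤ→ℚ (altSign i)
  scaled i = trans (cong (ℕ→ℚ (suc i) *_) (logCoeff-suc i)) (ℕ→ℚ-*-/-cancel i (altSign i))

θ-δ₀ : θ (δ 0) ≗ 0ₛ
θ-δ₀ zero    = refl
θ-δ₀ (suc m) =
  trans (cong₂ _+_ (ℚP.*-zeroʳ (ℕ→ℚ (suc (suc m)))) (ℚP.*-zeroʳ (ℕ→ℚ (suc m)))) (ℚP.+-identityʳ 0ℚ)

θ-logCoeff^⊛-suc : ∀ k → θ (logCoeff ^⊛ suc k) ≗ ℕ→ℚ (suc k) ·ₛ logCoeff ^⊛ k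
θ-logCoeff^⊛-suc k m = begin
  θ (logCoeff ⊛ logCoeff ^⊛ k) m
    ≡⟨ θ-leibniz logCoeff (logCoeff ^⊛ k) m ⟩
  (θ logCoeff ⊛ logCoeff ^⊛ k) m + (logCoeff ⊛ θ (logCoeff ^⊛ k)) m
    ≡⟨ cong₂ _+_ (trans (⊛-cong θ-logCoeff (λ _ → refl) m) (⊛-identityˡ (logCoeff ^⊛ k) m))
                 (logCoeff-⊛-θ k) ⟩
  (logCoeff ^⊛ k) m + ℕ→ℚ k * (logCoeff ^⊛ k) m
    ≡⟨ solve 2 (λ p c → p :+ c :* p := (con 1ℚ :+ c) :* p) refl ((logCoeff ^⊛ k) m) (ℕ→ℚ k) ⟩
  (1ℚ + ℕ→ℚ k) * (logCoeff ^⊛ k) m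
    ≡⟨ cong (_* (logCoeff ^⊛ k) m) (ℕ→ℚ-suc k) ⟨
  ℕ→ℚ (suc k) * (logCoeff ^⊛ k) m ∎
  where
  logCoeff-⊛-θ : ∀ j → (logCoeff ⊛ θ (logCoeff ^⊛ j)) m ≡ ℕ→ℚ j * (logCoeff ^⊛ j) m
  logCoeff-⊛-θ zero    = begin
    (logCoeff ⊛ θ (δ 0)) m ≡⟨ ⊛-cong (λ _ → refl) θ-δ₀ m ⟩
    (logCoeff ⊛ 0ₛ) m      ≡⟨ ⊛-zeroʳ logCoeff m ⟩
    0ℚ                     ≡⟨ ℚP.*-zeroˡ (δ 0 m) ⟨
    0ℚ * δ 0 m             ∎
  logCoeff-⊛-θ (suc j) =
    trans (⊛-cong (λ _ → refl) (θ-logCoeff^⊛-suc j) m)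
          (⊛-scaleʳ logCoeff (ℕ→ℚ (suc j)) (logCoeff ^⊛ j) m)

stirling1ℚ : ℕ → ℕ → ℚ
stirling1ℚ m k = ℤ→ℚ (stirling1 m k)

stirling1ℚ-suc-zero : ∀ m → stirling1ℚ (suc m) 0 ≡ - (ℕ→ℚ m * stirling1ℚ m 0)
stirling1ℚ-suc-zero m =
  trans (ℤ→ℚ-homo‿- (ℤ.+ m ℤ.* stirling1 m 0)) (cong -_ (ℤ→ℚ-homo-* (ℤ.+ m) (stirling1 m 0)))

stirling1ℚ-suc-suc : ∀ m k →
  stirling1ℚ (suc m) (suc k) ≡ stirling1ℚ m k + - (ℕ→ℚ m * stirling1ℚ m (suc k))
stirling1ℚ-suc-suc m k = begin
  ℤ→ℚ (stirling1 m k ℤ.- ℤ.+ m ℤ.* stirling1 m (suc k))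
    ≡⟨ ℤ→ℚ-homo-+ (stirling1 m k) (ℤ.- (ℤ.+ m ℤ.* stirling1 m (suc k))) ⟩
  stirling1ℚ m k + ℤ→ℚ (ℤ.- (ℤ.+ m ℤ.* stirling1 m (suc k)))
    ≡⟨ cong (stirling1ℚ m k +_) (ℤ→ℚ-homo‿- (ℤ.+ m ℤ.* stirling1 m (suc k))) ⟩
  stirling1ℚ m k + - ℤ→ℚ (ℤ.+ m ℤ.* stirling1 m (suc k))
    ≡⟨ cong (λ t → stirling1ℚ m k + - t) (ℤ→ℚ-homo-* (ℤ.+ m) (stirling1 m (suc k))) ⟩
  stirling1ℚ m k + - (ℕ→ℚ m * stirling1ℚ m (suc k)) ∎

stirling1-above : ∀ m k → m < k → stirling1 m k ≡ ℤ.+ 0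
stirling1-above zero    (suc k) _         = refl
stirling1-above (suc m) (suc k) (s≤s m<k)
  rewrite stirling1-above m k m<k | stirling1-above m (suc k) (ℕP.m<n⇒m<1+n m<k) | ℤP.*-zeroʳ (ℤ.+ m) = refl

logCoeff^⊛-stirling1 : ∀ m k → ℕ→ℚ (m !) * (logCoeff ^⊛ k) m ≡ ℕ→ℚ (k !) * stirling1ℚ m k
logCoeff^⊛-stirling1 zero    zero    = refl
logCoeff^⊛-stirling1 zero    (suc k) =
  trans (cong (ℕ→ℚ 1 *_) (ℚP.*-zeroˡ ((logCoeff ^⊛ k) 0)))
        (trans (ℚP.*-zeroʳ (ℕ→ℚ 1)) (sym (ℚP.*-zeroʳ (ℕ→ℚ (suc k !)))))
logCoeff^⊛-stirling1 (suc m) k = begin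
  ℕ→ℚ (suc m !) * P k (suc m)
    ≡⟨ cong (_* P k (suc m)) (ℕ→ℚ-homo-* (suc m) (m !)) ⟩
  ℕ→ℚ (suc m) * F * P k (suc m)
    ≡⟨ solve 5 (λ c f p′ k p → c :* f :* p′ := f :* (c :* p′ :+ k :* p) :+ :- (k :* (f :* p)))
         refl (ℕ→ℚ (suc m)) F (P k (suc m)) (ℕ→ℚ m) (P k m) ⟩
  F * θ (P k) m + - (ℕ→ℚ m * (F * P k m))
    ≡⟨ cong (λ t → F * θ (P k) m + - (ℕ→ℚ m * t)) (logCoeff^⊛-stirling1 m k) ⟩
  F * θ (P k) m + - (ℕ→ℚ m * (ℕ→ℚ (k !) * stirling1ℚ m k))
    ≡⟨ stirling-step k ⟩
  ℕ→ℚ (k !) * stirling1ℚ (suc m) k ∎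
  where
  P : ℕ → Series
  P k = logCoeff ^⊛ k
  F : ℚ
  F = ℕ→ℚ (m !)
  stirling-step : ∀ k → F * θ (P k) m + - (ℕ→ℚ m * (ℕ→ℚ (k !) * stirling1ℚ m k))
                      ≡ ℕ→ℚ (k !) * stirling1ℚ (suc m) k
  stirling-step zero = begin
    F * θ (δ 0) m + - (ℕ→ℚ m * (1ℚ * stirling1ℚ m 0))
      ≡⟨ cong (λ t → F * t + - (ℕ→ℚ m * (1ℚ * stirling1ℚ m 0))) (θ-δ₀ m) ⟩
    F * 0ℚ + - (ℕ→ℚ m * (1ℚ * stirling1ℚ m 0))
      ≡⟨ solve 3 (λ f k s → f :* con 0ℚ :+ :- (k :* (con 1ℚ :* s)) := con 1ℚ :* :- (k :* s))
           refl F (ℕ→ℚ m) (stirling1ℚ m 0) ⟩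
    1ℚ * - (ℕ→ℚ m * stirling1ℚ m 0)
      ≡⟨ cong (1ℚ *_) (stirling1ℚ-suc-zero m) ⟨
    1ℚ * stirling1ℚ (suc m) 0 ∎
  stirling-step (suc j) = begin
    F * θ (P (suc j)) m + - (ℕ→ℚ m * (ℕ→ℚ (suc j !) * stirling1ℚ m (suc j)))
      ≡⟨ cong₂ (λ t u → F * t + - (ℕ→ℚ m * (u * stirling1ℚ m (suc j))))
               (θ-logCoeff^⊛-suc j m) (ℕ→ℚ-homo-* (suc j) (j !)) ⟩
    F * (K * P j m) + R
      ≡⟨ cong (_+ R) (*-exchange F K (P j m)) ⟩
    K * (F * P j m) + R
      ≡⟨ cong (λ t → K * t + R) (logCoeff^⊛-stirling1 m j) ⟩
    K * (G * stirling1ℚ m j) + - (ℕ→ℚ m * (K * G * stirling1ℚ m (suc j)))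
      ≡⟨ solve 5 (λ c g s k s′ → c :* (g :* s) :+ :- (k :* (c :* g :* s′))
                                 := c :* g :* (s :+ :- (k :* s′)))
           refl K G (stirling1ℚ m j) (ℕ→ℚ m) (stirling1ℚ m (suc j)) ⟩
    K * G * (stirling1ℚ m j + - (ℕ→ℚ m * stirling1ℚ m (suc j)))
      ≡⟨ cong₂ _*_ (ℕ→ℚ-homo-* (suc j) (j !)) (stirling1ℚ-suc-suc m j) ⟨
    ℕ→ℚ (suc j !) * stirling1ℚ (suc m) (suc j) ∎
    where
    K G R : ℚ
    K = ℕ→ℚ (suc j)
    G = ℕ→ℚ (j !)
    R = - (ℕ→ℚ m * (K * G * stirling1ℚ m (suc j)))

logCoeff^⊛-coefficient : ∀ k m → inv! k * (logCoeff ^⊛ k) m ≡ inv! m * stirling1ℚ m k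
logCoeff^⊛-coefficient k m = begin
  inv! k * P
    ≡⟨ ℚP.*-identityˡ (inv! k * P) ⟨
  1ℚ * (inv! k * P)
    ≡⟨ cong (_* (inv! k * P)) (inv!-inverseˡ m) ⟨
  inv! m * ℕ→ℚ (m !) * (inv! k * P)
    ≡⟨ solve 4 (λ a b c d → a :* b :* (c :* d) := a :* c :* (b :* d))
         refl (inv! m) (ℕ→ℚ (m !)) (inv! k) P ⟩
  inv! m * inv! k * (ℕ→ℚ (m !) * P)
    ≡⟨ cong (inv! m * inv! k *_) (logCoeff^⊛-stirling1 m k) ⟩
  inv! m * inv! k * (ℕ→ℚ (k !) * stirling1ℚ m k)
    ≡⟨ solve 4 (λ a c e s → a :* c :* (e :* s) := a :* s :* (c :* e))
         refl (inv! m) (inv! k) (ℕ→ℚ (k !)) (stirling1ℚ m k) ⟩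
  inv! m * stirling1ℚ m k * (inv! k * ℕ→ℚ (k !))
    ≡⟨ cong (inv! m * stirling1ℚ m k *_) (inv!-inverseˡ k) ⟩
  inv! m * stirling1ℚ m k * 1ℚ
    ≡⟨ ℚP.*-identityʳ (inv! m * stirling1ℚ m k) ⟩
  inv! m * stirling1ℚ m k ∎
  where
  P : ℚ
  P = (logCoeff ^⊛ k) m

sumMap : ∀ {A : Set} → (A → ℚ) → List A → ℚ
sumMap F = foldr (λ p s → F p + s) 0ℚ

sumMap-unique : ∀ {A : Set} {T : List A → ℚ} (F : A → ℚ) →
  T [] ≡ 0ℚ → (∀ p ps → T (p ∷ ps) ≡ F p + T ps) → ∀ L → T L ≡ sumMap F L
sumMap-unique F T[] T∷ []       = T[]
sumMap-unique F T[] T∷ (p ∷ ps) = trans (T∷ p ps) (cong (F p +_) (sumMap-unique F T[] T∷ ps))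

-- The sum in _⋆_ is local to its definition, so it is identified with sumMap
-- through its recursion equations; abstracting splits w makes it unifiable.
⋆-as-sumMap : ∀ f g w → (f ⋆ g) w ≡ sumMap (uncurry λ u v → f u * g v) (splits w)
⋆-as-sumMap f g w with sumMap-unique (uncurry λ u v → f u * g v) refl (λ _ _ → refl) | splits w
... | unique | L = unique L

sumMap-splits : ∀ F G w →
  sumMap (uncurry λ u v → F (length u) * G (length v)) (splits w) ≡ (F ⊛ G) (length w)
sumMap-splits F G []       = ℚP.+-identityʳ (F 0 * G 0)
sumMap-splits F G (x ∷ xs) =
  cong (F 0 * G (suc (length xs)) +_)
       (trans (foldr-map _ _ 0ℚ (splits xs)) (sumMap-splits (tail F) G xs))

⋆-byLength : ∀ {f g F G} → (∀ u → f u ≡ F (length u)) → (∀ v → g v ≡ G (length v)) →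
  ∀ w → (f ⋆ g) w ≡ (F ⊛ G) (length w)
⋆-byLength {f} {g} {F} {G} f≡F g≡G w = begin
  (f ⋆ g) w
    ≡⟨ ⋆-as-sumMap f g w ⟩
  sumMap (uncurry λ u v → f u * g v) (splits w)
    ≡⟨ foldr-cong (λ { (u , v) s → cong (_+ s) (cong₂ _*_ (f≡F u) (g≡G v)) }) refl (splits w) ⟩
  sumMap (uncurry λ u v → F (length u) * G (length v)) (splits w)
    ≡⟨ sumMap-splits F G w ⟩
  (F ⊛ G) (length w) ∎

unit-byLength : ∀ w → unit w ≡ δ 0 (length w)
unit-byLength []      = refl
unit-byLength (_ ∷ _) = refl

^⋆-byLength : ∀ {f F} → (∀ u → f u ≡ F (length u)) → ∀ k w → (f ^⋆ k) w ≡ (F ^⊛ k) (length w)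
^⋆-byLength f≡F zero    = unit-byLength
^⋆-byLength f≡F (suc k) = ⋆-byLength f≡F (^⋆-byLength f≡F k)

σ₁-1-byLength : ∀ w → σ₁-1 w ≡ δ 1 (length w)
σ₁-1-byLength []          = refl
σ₁-1-byLength (_ ∷ [])    = refl
σ₁-1-byLength (_ ∷ _ ∷ _) = refl

φ-byLength : ∀ w → φ w ≡ logCoeff (length w)
φ-byLength []       = refl
φ-byLength (x ∷ xs) = begin
  Σ₁ m (λ j → logCoeff j * (σ₁-1 ^⋆ j) (x ∷ xs))
    ≡⟨ Σ₁-cong m (λ j → cong (logCoeff j *_)
                             (trans (^⋆-byLength σ₁-1-byLength j (x ∷ xs)) (δ₁-^⊛ j m))) ⟩
  Σ₁ m (λ j → logCoeff j * δ m j)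
    ≡⟨ Σ₁-δ m m logCoeff (s≤s z≤n) ℕP.≤-refl ⟩
  logCoeff m ∎
  where
  m : ℕ
  m = suc (length xs)

φ^⋆-coefficient : ∀ k w → inv! k * (φ ^⋆ k) w ≡ inv! (length w) * stirling1ℚ (length w) k
φ^⋆-coefficient k w =
  trans (cong (inv! k *_) (^⋆-byLength φ-byLength k w)) (logCoeff^⊛-coefficient k (length w))

length≤deg : ∀ w → length w ≤ deg w
length≤deg []       = z≤n
length≤deg (x ∷ xs) = s≤s (ℕP.≤-trans (length≤deg xs) (ℕP.m≤n+m (deg xs) x))

1≤deg⇒1≤length : ∀ w → 1 ≤ deg w → 1 ≤ length w
1≤deg⇒1≤length (_ ∷ _) _ = s≤s z≤n

RHS-coefficient : ℕ → ℕ → ℕ → ℚ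
RHS-coefficient a b r = inv! r * Σ₁ r (λ k → stirling1ℚ r k * E k a b)

mainTheorem4 : (n : ℕ) → 1 ≤ n → (w : Word) → (a b : ℕ) →
    Ycomp n w a b ≡ RHS n w a b
mainTheorem4 n 1≤n w a b with deg w ≡ᵇ n in deg≡ᵇn
... | false =
  sym (Σ₁-zero n (λ r → RHS-coefficient a b r * 0ℚ) (λ r _ → ℚP.*-zeroʳ (RHS-coefficient a b r)))
... | true  = begin
  Σ₁ n (λ k → inv! k * (φ ^⋆ k) w * E k a b)
    ≡⟨ Σ₁-cong n (λ k → trans (cong (_* E k a b) (φ^⋆-coefficient k w))
                              (ℚP.*-assoc (inv! m) (stirling1ℚ m k) (E k a b))) ⟩
  Σ₁ n (λ k → inv! m * summand k)
    ≡⟨ *-distribˡ-Σ₁ n (inv! m) summand ⟨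
  inv! m * Σ₁ n summand
    ≡⟨ cong (inv! m *_) (Σ₁-truncate n m summand m≤n (λ k m<k →
         trans (cong (_* E k a b) (cong ℤ→ℚ (stirling1-above m k m<k))) (ℚP.*-zeroˡ (E k a b)))) ⟩
  RHS-coefficient a b m
    ≡⟨ Σ₁-δ n m (RHS-coefficient a b) 1≤m m≤n ⟨
  Σ₁ n (λ r → RHS-coefficient a b r * δ m r) ∎
  where
  m : ℕ
  m = length w
  summand : ℕ → ℚ
  summand k = stirling1ℚ m k * E k a b
  deg≡n : deg w ≡ n
  deg≡n = ℕP.≡ᵇ⇒≡ (deg w) n (subst T (sym deg≡ᵇn) _)
  m≤n : m ≤ n
  m≤n = subst (m ≤_) deg≡n (length≤deg w)
  1≤m : 1 ≤ m
  1≤m = 1≤deg⇒1≤length w (subst (1 ≤_) (sym deg≡n) 1≤n)
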